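{- Let $t,\ell,\lambda$ be integers with $t>\ell\ge0$, $\lambda\ge1$. There is a constant $c_3$ (depending only on $t,\ell,\lambda$) such that for every $m\ge t+\ell+\lambda+2$ and every $m$-rowed $(0,1)$-matrix $A$ with $(\lambda+2)\cdot{\bf 1}_t{\bf 0}_\ell\not\prec A$, all column sums in $\{t,\dots,m-\ell\}$, no repeated column of column sum $t$, and more than $\left(1+\frac{\lambda}{t+1}\right)\binom{m}{t}$ columns, the set $$Y=\Big\{S\in\binom{[m]}{t}: d(S)=\lambda\text{ and }\mu(S)=1\Big\}$$ satisfies $|Y|\ge\binom{m}{t}-c_3m^{t-1}$.
   Context: For a column $\alpha$, $I(\alpha)$ is the set of rows where $\alpha$ has a $1$. ${\cal A}_t$ is the set of $I(\alpha)$ over columns $\alpha$ of $A$ of sum $t$, and ${\cal A}_{t+1}$ the multiset of $I(\alpha)$ over columns of sum $t+1$. For $S\in\binom{[m]}{t}$, $\mu(S)=1$ if $S\in{\cal A}_t$ and $0$ otherwise; $d(S)$ is the number of members of ${\cal A}_{t+1}$ (with multiplicity) containing $S$. ${\bf 1}_t{\bf 0}_\ell$ is the column of $t$ ones above $\ell$ zeros, $q\cdot{\bf v}$ is $q$ copies of ${\bf v}$, and $F\prec A$ means some submatrix of $A$ is a row and column permutation of $F$. -}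

module Defs where

open import Data.Nat using (ℕ; zero; suc; _+_; _∸_; _≡ᵇ_)
open import Data.Bool using (Bool; true; false; _∧_; _∨_; not; if_then_else_)
open import Data.Fin using (Fin; zero; suc)
open import Data.List using (List; []; _∷_; map; _++_; length; filter)
open import Data.Product using (Σ; _×_)
open import Function.Definitions using (Injective)
open import Relation.Binary.PropositionalEquality using (_≡_)

Matrix : ℕ → ℕ → Set
Matrix m n = Fin m → Fin n → Bool

countF : ∀ {n} → (Fin n → Bool) → ℕ
countF {zero}  p = 0
countF {suc n} p = (if p zero then 1 else 0) + countF (λ k → p (suc k))

allF : ∀ {n} → (Fin n → Bool) → Bool
allF {zero}  p = true
allF {suc n} p = p zero ∧ allF (λ k → p (suc k))

anyF : ∀ {n} → (Fin n → Bool) → Bool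
anyF {zero}  p = false
anyF {suc n} p = p zero ∨ anyF (λ k → p (suc k))

_==ᵇ_ : Bool → Bool → Bool
true  ==ᵇ b = b
false ==ᵇ b = not b

Subset : ℕ → Set
Subset m = Fin m → Bool

allSubsets : (m : ℕ) → List (Subset m)
allSubsets zero = (λ ()) ∷ []
allSubsets (suc m) =
  map (λ S → λ { zero → false ; (suc i) → S i }) (allSubsets m) ++
  map (λ S → λ { zero → true  ; (suc i) → S i }) (allSubsets m)

∣_∣ : ∀ {m} → Subset m → ℕ
∣ S ∣ = countF S

I : ∀ {m n} → Matrix m n → Fin n → Subset m
I A j = λ i → A i j

colSum : ∀ {m n} → Matrix m n → Fin n → ℕ
colSum A j = ∣ I A j ∣

sameSet : ∀ {m} → Subset m → Subset m → Bool
sameSet S T = allF (λ i → S i ==ᵇ T i)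

subsetᵇ : ∀ {m} → Subset m → Subset m → Bool
subsetᵇ S T = allF (λ i → not (S i) ∨ T i)

μ : ∀ {m n} → ℕ → Matrix m n → Subset m → ℕ
μ t A S = if anyF (λ j → (colSum A j ≡ᵇ t) ∧ sameSet S (I A j)) then 1 else 0

d : ∀ {m n} → ℕ → Matrix m n → Subset m → ℕ
d t A S = countF (λ j → (colSum A j ≡ᵇ suc t) ∧ subsetᵇ S (I A j))

Yset : ∀ {m n} → ℕ → ℕ → Matrix m n → List (Subset m)
Yset {m} t lam A =
  filter (λ S → Data.Bool._≟_ (((∣ S ∣ ≡ᵇ t) ∧ (d t A S ≡ᵇ lam)) ∧ (μ t A S ≡ᵇ 1)) true)
         (allSubsets m)
  where import Data.Bool

-- F ≺ A : some submatrix of A is a row and column permutation of F, i.e.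
-- there are injective maps of rows and columns of F into those of A
-- with A (ρ i) (σ j) = F i j.
_≺_ : ∀ {k p m n} → Matrix k p → Matrix m n → Set
_≺_ {k} {p} {m} {n} F A =
  Σ (Fin k → Fin m) λ ρ → Σ (Fin p → Fin n) λ σ →
    Injective _≡_ _≡_ ρ × Injective _≡_ _≡_ σ × (∀ i j → A (ρ i) (σ j) ≡ F i j)

onesZeros : (t ℓ : ℕ) → Fin (t + ℓ) → Bool
onesZeros zero    ℓ i       = false
onesZeros (suc t) ℓ zero    = true
onesZeros (suc t) ℓ (suc i) = onesZeros t ℓ i

copies : ∀ {k} → (q : ℕ) → (Fin k → Bool) → Matrix k q
copies q v i j = v i

-- Double counting over the t-subsets S of [m].  Truncate each column j to the set top j
-- of its first t + 2 ones and give S the weight t·[S is a column of sum t] + #{j : S ⊆ top j}.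
-- Every column then contributes t + 1 to the total weight, plus an excess
-- δ = C(t+2,t) − (t+1) ≥ 1 if its sum is at least t + 2.  If S has an element p beyond row
-- M₀ = ℓ + (λ'+2)(t+2), at most λ' + 1 tops contain S: otherwise the rows above p that miss
-- λ' + 2 such tops, at least ℓ of them, give (λ'+2)·1_t0_ℓ.  A case check then bounds the
-- weight of such S by t + 1 + λ', with one to spare unless S ∈ Y or S lies in the top of a
-- large column.  The other t-sets lie in the first M₀ rows, so there are at most C(M₀,t) of
-- them, and their weight is O(C(m,ℓ)) by a pigeonhole over the first ℓ zeros of the columns.
-- Comparing with the total weight, which exceeds (t+1+λ')C(m,t) + δ·#{large columns}, bounds
-- first the number of large columns and then the number of t-sets outside Y by O(m^ℓ).

module Submission where

open import Defs
open import Data.Bool using (Bool; true; false; _∧_; _∨_; not; if_then_else_)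
open import Data.Bool.Properties using (∧-zeroʳ; ∧-identityʳ)
open import Data.Empty using (⊥; ⊥-elim)
open import Data.Fin using (Fin; zero; suc; toℕ; splitAt; join; _↑ʳ_)
open import Data.Fin.Properties using (toℕ<n; join-splitAt) renaming (suc-injective to Fin-suc-injective)
open import Data.List using (List; []; _∷_; map; _++_; length; filter)
open import Data.Nat
  using (ℕ; zero; suc; _+_; _*_; _∸_; _^_; _≤_; _<_; z≤n; s≤s; _≡ᵇ_; _≤ᵇ_; _<ᵇ_; _⊓_; _≤?_; _≟_; >-nonZero)
open import Data.Nat.Combinatorics using (_C_; nCk+nC[k+1]≡[n+1]C[k+1])
open import Data.Nat.Properties
open import Algebra.Properties.Semiring.Sum +-*-semiring
  using (sum; sum-cong-≗; ∑-distrib-+; ∑-comm; *-distribˡ-sum)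
open import Data.Nat.Tactic.RingSolver using (solve-∀)
open import Data.Product using (Σ; _×_; _,_; proj₁; proj₂)
open import Data.Sum using (_⊎_; inj₁; inj₂; [_,_]′)
open import Data.Sum.Properties using ([,]-map)
open import Data.Unit using (tt)
open import Function using (_∘_)
open import Function.Definitions using (Injective)
open import Relation.Binary.PropositionalEquality
open import Relation.Nullary using (¬_; yes; no)

private
  variable
    m n : ℕ

false≢true : false ≢ true
false≢true ()

true-or-false : ∀ b → b ≡ true ⊎ b ≡ false
true-or-false true  = inj₁ refl
true-or-false false = inj₂ refl

≡true⇒T : ∀ {b} → b ≡ true → Data.Bool.T b
≡true⇒T refl = tt

≢true⇒≡false : ∀ {b} → ¬ (b ≡ true) → b ≡ false
≢true⇒≡false {false} _ = refl
≢true⇒≡false {true}  ¬b = ⊥-elim (¬b refl)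

∧-true⇒ : ∀ {a b} → a ∧ b ≡ true → a ≡ true × b ≡ true
∧-true⇒ {true} {true} _ = refl , refl

⇒∧-true : ∀ {a b} → a ≡ true → b ≡ true → a ∧ b ≡ true
⇒∧-true refl refl = refl

not-true⇒ : ∀ {b} → not b ≡ true → b ≡ false
not-true⇒ {false} _ = refl

not-false⇒ : ∀ {b} → not b ≡ false → b ≡ true
not-false⇒ {true} _ = refl

==ᵇ-true⇒ : ∀ {a b} → (a ==ᵇ b) ≡ true → a ≡ b
==ᵇ-true⇒ {true}  {true}  _ = refl
==ᵇ-true⇒ {false} {false} _ = refl

==ᵇ-refl : ∀ a → (a ==ᵇ a) ≡ true
==ᵇ-refl true  = refl
==ᵇ-refl false = refl

≡ᵇ-true⇒ : (m ≡ᵇ n) ≡ true → m ≡ n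
≡ᵇ-true⇒ {m} {n} e = ≡ᵇ⇒≡ m n (≡true⇒T e)

⇒≡ᵇ-true : m ≡ n → (m ≡ᵇ n) ≡ true
⇒≡ᵇ-true {m} {n} e with m ≡ᵇ n | ≡⇒≡ᵇ m n e
... | true | _ = refl

<ᵇ-true⇒ : (m <ᵇ n) ≡ true → m < n
<ᵇ-true⇒ {m} {n} e = <ᵇ⇒< m n (≡true⇒T e)

⇒<ᵇ-true : m < n → (m <ᵇ n) ≡ true
⇒<ᵇ-true {m} {n} m<n with m <ᵇ n | <⇒<ᵇ m<n
... | true | _ = refl

≤ᵇ-true⇒ : (m ≤ᵇ n) ≡ true → m ≤ n
≤ᵇ-true⇒ {m} {n} e = ≤ᵇ⇒≤ m n (≡true⇒T e)

⇒≤ᵇ-true : m ≤ n → (m ≤ᵇ n) ≡ true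
⇒≤ᵇ-true {m} {n} m≤n with m ≤ᵇ n | ≤⇒≤ᵇ m≤n
... | true | _ = refl

≤ᵇ-false⇒ : (m ≤ᵇ n) ≡ false → n < m
≤ᵇ-false⇒ e = ≰⇒> λ m≤n → false≢true (trans (sym e) (⇒≤ᵇ-true m≤n))

allF-true⇒ : ∀ {p : Fin n → Bool} → allF p ≡ true → ∀ i → p i ≡ true
allF-true⇒ {suc n} e zero    = proj₁ (∧-true⇒ e)
allF-true⇒ {suc n} e (suc i) = allF-true⇒ (proj₂ (∧-true⇒ e)) i

⇒allF-true : ∀ {p : Fin n → Bool} → (∀ i → p i ≡ true) → allF p ≡ true
⇒allF-true {zero}  h = refl
⇒allF-true {suc n} h = ⇒∧-true (h zero) (⇒allF-true (h ∘ suc))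

allF-false⇒ : ∀ {p : Fin n → Bool} → allF p ≡ false → Σ (Fin n) λ i → p i ≡ false
allF-false⇒ {suc n} {p} e with p zero in eq
... | false = zero , eq
... | true  = let i , q = allF-false⇒ e in suc i , q

anyF-true⇒ : ∀ {p : Fin n → Bool} → anyF p ≡ true → Σ (Fin n) λ i → p i ≡ true
anyF-true⇒ {suc n} {p} e with p zero in eq
... | true  = zero , eq
... | false = let i , q = anyF-true⇒ e in suc i , q

⇒anyF-true : ∀ {p : Fin n → Bool} i → p i ≡ true → anyF p ≡ true
⇒anyF-true {suc n} zero    e rewrite e = refl
⇒anyF-true {suc n} {p} (suc i) e with p zero
... | true  = refl
... | false = ⇒anyF-true i e

anyF-false⇒ : ∀ {p : Fin n → Bool} → anyF p ≡ false → ∀ i → p i ≡ false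
anyF-false⇒ e i = ≢true⇒≡false λ pi → false≢true (trans (sym e) (⇒anyF-true i pi))

sameSet-true⇒ : ∀ (S U : Subset m) → sameSet S U ≡ true → ∀ i → S i ≡ U i
sameSet-true⇒ S U e i = ==ᵇ-true⇒ (allF-true⇒ e i)

⇒sameSet-true : ∀ {S U : Subset m} → (∀ i → S i ≡ U i) → sameSet S U ≡ true
⇒sameSet-true {S = S} h = ⇒allF-true λ i → subst (λ b → (S i ==ᵇ b) ≡ true) (h i) (==ᵇ-refl (S i))

subsetᵇ-true⇒ : ∀ (S U : Subset m) → subsetᵇ S U ≡ true → ∀ i → S i ≡ true → U i ≡ true
subsetᵇ-true⇒ S U e i si = subst (λ b → not b ∨ _ ≡ true) si (allF-true⇒ e i)

⇒subsetᵇ-true : ∀ {S U : Subset m} → (∀ i → S i ≡ true → U i ≡ true) → subsetᵇ S U ≡ true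
⇒subsetᵇ-true {S = S} {U} h = ⇒allF-true λ i → implies (S i) (U i) (h i)
  where
  implies : ∀ a b → (a ≡ true → b ≡ true) → not a ∨ b ≡ true
  implies false b _ = refl
  implies true  b f = f refl

subsetᵇ-congʳ : ∀ (S : Subset m) {U V : Subset m} → (∀ i → U i ≡ V i) → subsetᵇ S U ≡ subsetᵇ S V
subsetᵇ-congʳ {zero}  S h = refl
subsetᵇ-congʳ {suc m} S h = cong₂ _∧_ (cong (not (S zero) ∨_) (h zero)) (subsetᵇ-congʳ (S ∘ suc) (h ∘ suc))

-- Finite sums and counting

𝟙 : Bool → ℕ
𝟙 b = if b then 1 else 0

𝟙-∧ : ∀ a b → 𝟙 (a ∧ b) ≡ 𝟙 a * 𝟙 b
𝟙-∧ true  b = sym (+-identityʳ (𝟙 b))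
𝟙-∧ false b = refl

sum-mono-≤ : ∀ {f g : Fin n → ℕ} → (∀ i → f i ≤ g i) → sum f ≤ sum g
sum-mono-≤ {zero}  h = z≤n
sum-mono-≤ {suc n} h = +-mono-≤ (h zero) (sum-mono-≤ (h ∘ suc))

sum-const : ∀ n k → sum {n} (λ _ → k) ≡ n * k
sum-const zero    k = refl
sum-const (suc n) k = cong (k +_) (sum-const n k)

≤-sum : ∀ (f : Fin n → ℕ) i → f i ≤ sum f
≤-sum f zero    = m≤m+n (f zero) _
≤-sum f (suc i) = ≤-trans (≤-sum (f ∘ suc) i) (m≤n+m _ (f zero))

countF≡sum : ∀ (p : Fin n → Bool) → countF p ≡ sum (𝟙 ∘ p)
countF≡sum {zero}  p = refl
countF≡sum {suc n} p = cong (𝟙 (p zero) +_) (countF≡sum (p ∘ suc))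

countF-cong : ∀ {p q : Fin n → Bool} → (∀ i → p i ≡ q i) → countF p ≡ countF q
countF-cong {p = p} {q} h = begin
  countF p      ≡⟨ countF≡sum p ⟩
  sum (𝟙 ∘ p)   ≡⟨ sum-cong-≗ (cong 𝟙 ∘ h) ⟩
  sum (𝟙 ∘ q)   ≡⟨ countF≡sum q ⟨
  countF q      ∎
  where open ≡-Reasoning

countF-mono : ∀ {p q : Fin n → Bool} → (∀ i → p i ≡ true → q i ≡ true) → countF p ≤ countF q
countF-mono {p = p} {q} h = begin
  countF p      ≡⟨ countF≡sum p ⟩
  sum (𝟙 ∘ p)   ≤⟨ sum-mono-≤ (λ i → 𝟙-mono (p i) (q i) (h i)) ⟩
  sum (𝟙 ∘ q)   ≡⟨ countF≡sum q ⟨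
  countF q      ∎
  where
  open ≤-Reasoning
  𝟙-mono : ∀ a b → (a ≡ true → b ≡ true) → 𝟙 a ≤ 𝟙 b
  𝟙-mono false b _ = z≤n
  𝟙-mono true  b f rewrite f refl = ≤-refl

countF-false : ∀ n → countF {n} (λ _ → false) ≡ 0
countF-false zero    = refl
countF-false (suc n) = countF-false n

countF-true : ∀ n → countF {n} (λ _ → true) ≡ n
countF-true zero    = refl
countF-true (suc n) = cong suc (countF-true n)

countF-complement : ∀ (p : Fin n → Bool) → countF p + countF (not ∘ p) ≡ n
countF-complement {zero}  p = refl
countF-complement {suc n} p with p zero
... | true  = cong suc (countF-complement (p ∘ suc))
... | false = trans (+-suc _ _) (cong suc (countF-complement (p ∘ suc)))

countF-<ᵇ : ∀ n c → countF {n} (λ i → toℕ i <ᵇ c) ≡ n ⊓ c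
countF-<ᵇ zero    c       = refl
countF-<ᵇ (suc n) zero    = countF-false (suc n)
countF-<ᵇ (suc n) (suc c) = cong suc (countF-<ᵇ n c)

countF≤0⇒ : ∀ (p : Fin n → Bool) → countF p ≤ 0 → ∀ i → p i ≡ false
countF≤0⇒ p c≤0 i = ≢true⇒≡false λ pi → 1+n≰n (begin
  1            ≡⟨ cong 𝟙 pi ⟨
  𝟙 (p i)      ≤⟨ ≤-sum (𝟙 ∘ p) i ⟩
  sum (𝟙 ∘ p)  ≡⟨ countF≡sum p ⟨
  countF p     ≤⟨ c≤0 ⟩
  0            ∎)
  where open ≤-Reasoning

enumerate : ∀ (p : Fin n → Bool) k → k ≤ countF p →
  Σ (Fin k → Fin n) λ f → Injective _≡_ _≡_ f × (∀ i → p (f i) ≡ true)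
enumerate p zero _ = (λ ()) , (λ { {()} }) , (λ ())
enumerate {suc n} p (suc k) k≤c with p zero in p0
... | false = let f , f-inj , f-ok = enumerate (p ∘ suc) (suc k) k≤c
              in suc ∘ f , f-inj ∘ Fin-suc-injective , f-ok
... | true  = g , g-inj , g-ok
  where
  rest : Σ (Fin k → Fin n) λ f → Injective _≡_ _≡_ f × (∀ i → p (suc (f i)) ≡ true)
  rest = enumerate (p ∘ suc) k (≤-pred k≤c)
  g : Fin (suc k) → Fin (suc n)
  g zero    = zero
  g (suc i) = suc (proj₁ rest i)
  g-inj : Injective _≡_ _≡_ g
  g-inj {zero}  {zero}  _ = refl
  g-inj {suc i} {suc j} e = cong suc (proj₁ (proj₂ rest) (Fin-suc-injective e))
  g-ok : ∀ i → p (g i) ≡ true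
  g-ok zero    = p0
  g-ok (suc i) = proj₂ (proj₂ rest) i

1≤countF⇒ : ∀ (p : Fin n → Bool) → 1 ≤ countF p → Σ (Fin n) λ i → p i ≡ true
1≤countF⇒ p 1≤c = let f , _ , f-ok = enumerate p 1 1≤c in f zero , f-ok zero

countF≤1 : ∀ (p : Fin n → Bool) → (∀ i j → p i ≡ true → p j ≡ true → i ≡ j) → countF p ≤ 1
countF≤1 p unique with countF p ≤? 1
... | yes c≤1 = c≤1
... | no  c≰1 with enumerate p 2 (≰⇒> c≰1)
...   | f , f-inj , f-ok with () ← f-inj {zero} {suc zero} (unique _ _ (f-ok zero) (f-ok (suc zero)))

countF-union-bound : ∀ {n k} (q : Fin n → Bool) (R : Fin k → Fin n → Bool) →
  countF q ≤ countF (λ r → q r ∧ allF (λ i → not (R i r))) + sum (λ i → countF (R i))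
countF-union-bound {n} q R = begin
  countF q                                              ≡⟨ countF≡sum q ⟩
  sum (𝟙 ∘ q)                                           ≤⟨ sum-mono-≤ pointwise ⟩
  sum (λ r → 𝟙 (q′ r) + sum (λ i → 𝟙 (R i r)))          ≡⟨ ∑-distrib-+ (𝟙 ∘ q′) _ ⟩
  sum (𝟙 ∘ q′) + sum (λ r → sum (λ i → 𝟙 (R i r)))      ≡⟨ cong₂ _+_ (countF≡sum q′) (∑-comm (λ i r → 𝟙 (R i r))) ⟨
  countF q′ + sum (λ i → sum (λ r → 𝟙 (R i r)))         ≡⟨ cong (countF q′ +_) (sum-cong-≗ (countF≡sum ∘ R)) ⟨
  countF q′ + sum (λ i → countF (R i))                  ∎
  where
  open ≤-Reasoning
  q′ : Fin n → Bool
  q′ r = q r ∧ allF (λ i → not (R i r))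
  pointwise : ∀ r → 𝟙 (q r) ≤ 𝟙 (q′ r) + sum (λ i → 𝟙 (R i r))
  pointwise r with q r
  ... | false = z≤n
  ... | true with allF (λ i → not (R i r)) in e
  ...   | true  = s≤s z≤n
  ...   | false = let i , Rir = allF-false⇒ e in
                  ≤-trans (≤-reflexive (cong 𝟙 (sym (not-false⇒ Rir)))) (≤-sum (λ i → 𝟙 (R i r)) i)

∑ˡ : ∀ {A : Set} → (A → ℕ) → List A → ℕ
∑ˡ f []       = 0
∑ˡ f (x ∷ xs) = f x + ∑ˡ f xs

module _ {A : Set} where

  ∑ˡ-cong : ∀ {f g : A → ℕ} xs → (∀ x → f x ≡ g x) → ∑ˡ f xs ≡ ∑ˡ g xs
  ∑ˡ-cong []       h = refl
  ∑ˡ-cong (x ∷ xs) h = cong₂ _+_ (h x) (∑ˡ-cong xs h)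

  ∑ˡ-mono-≤ : ∀ {f g : A → ℕ} xs → (∀ x → f x ≤ g x) → ∑ˡ f xs ≤ ∑ˡ g xs
  ∑ˡ-mono-≤ []       h = z≤n
  ∑ˡ-mono-≤ (x ∷ xs) h = +-mono-≤ (h x) (∑ˡ-mono-≤ xs h)

  ∑ˡ-zero : ∀ {f : A → ℕ} xs → (∀ x → f x ≡ 0) → ∑ˡ f xs ≡ 0
  ∑ˡ-zero []       h = refl
  ∑ˡ-zero (x ∷ xs) h rewrite h x = ∑ˡ-zero xs h

  ∑ˡ-distrib-+ : ∀ (f g : A → ℕ) xs → ∑ˡ (λ x → f x + g x) xs ≡ ∑ˡ f xs + ∑ˡ g xs
  ∑ˡ-distrib-+ f g []       = refl
  ∑ˡ-distrib-+ f g (x ∷ xs) rewrite ∑ˡ-distrib-+ f g xs = +-+-comm (f x) (g x) _ _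
    where
    +-+-comm : ∀ a b c d → a + b + (c + d) ≡ a + c + (b + d)
    +-+-comm = solve-∀

  ∑ˡ-distribˡ-* : ∀ k (f : A → ℕ) xs → ∑ˡ (λ x → k * f x) xs ≡ k * ∑ˡ f xs
  ∑ˡ-distribˡ-* k f []       = sym (*-zeroʳ k)
  ∑ˡ-distribˡ-* k f (x ∷ xs) rewrite ∑ˡ-distribˡ-* k f xs = sym (*-distribˡ-+ k (f x) _)

  ∑ˡ-distribʳ-* : ∀ k (f : A → ℕ) xs → ∑ˡ (λ x → f x * k) xs ≡ ∑ˡ f xs * k
  ∑ˡ-distribʳ-* k f xs =
    trans (∑ˡ-cong xs (λ x → *-comm (f x) k)) (trans (∑ˡ-distribˡ-* k f xs) (*-comm k _))

  ∑ˡ-++ : ∀ (f : A → ℕ) xs ys → ∑ˡ f (xs ++ ys) ≡ ∑ˡ f xs + ∑ˡ f ys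
  ∑ˡ-++ f []       ys = refl
  ∑ˡ-++ f (x ∷ xs) ys rewrite ∑ˡ-++ f xs ys = sym (+-assoc (f x) _ _)

  ∑ˡ-map : ∀ {B : Set} (f : A → ℕ) (g : B → A) xs → ∑ˡ f (map g xs) ≡ ∑ˡ (f ∘ g) xs
  ∑ˡ-map f g []       = refl
  ∑ˡ-map f g (x ∷ xs) = cong (f (g x) +_) (∑ˡ-map f g xs)

  ∑ˡ-sum-comm : ∀ (f : A → Fin n → ℕ) xs → ∑ˡ (λ x → sum (f x)) xs ≡ sum (λ j → ∑ˡ (λ x → f x j) xs)
  ∑ˡ-sum-comm {n} f []       = sym (trans (sum-const n 0) (*-zeroʳ n))
  ∑ˡ-sum-comm     f (x ∷ xs) = trans (cong (sum (f x) +_) (∑ˡ-sum-comm f xs)) (sym (∑-distrib-+ (f x) _))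

  length-filter : ∀ (p : A → Bool) xs →
    length (filter (λ x → Data.Bool._≟_ (p x) true) xs) ≡ ∑ˡ (𝟙 ∘ p) xs
  length-filter p []       = refl
  length-filter p (x ∷ xs) with p x
  ... | true  = cong suc (length-filter p xs)
  ... | false = length-filter p xs

  ∑ˡ-map-++-map : ∀ {B : Set} (f : A → ℕ) (g h : B → A) xs →
    ∑ˡ f (map g xs ++ map h xs) ≡ ∑ˡ (f ∘ g) xs + ∑ˡ (f ∘ h) xs
  ∑ˡ-map-++-map f g h xs =
    trans (∑ˡ-++ f (map g xs) (map h xs)) (cong₂ _+_ (∑ˡ-map f g xs) (∑ˡ-map f h xs))

-- Binomial coefficients

binomial : ℕ → ℕ → ℕ
binomial n       zero    = 1
binomial zero    (suc k) = 0
binomial (suc n) (suc k) = binomial n k + binomial n (suc k)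

binomial≡C : ∀ n k → binomial n k ≡ n C k
binomial≡C n       zero    = refl
binomial≡C zero    (suc k) = refl
binomial≡C (suc n) (suc k) =
  trans (cong₂ _+_ (binomial≡C n k) (binomial≡C n (suc k))) (nCk+nC[k+1]≡[n+1]C[k+1] n k)

binomial-< : ∀ n k → n < k → binomial n k ≡ 0
binomial-< zero    (suc k) _         = refl
binomial-< (suc n) (suc k) (s≤s n<k) = cong₂ _+_ (binomial-< n k n<k) (binomial-< n (suc k) (m<n⇒m<1+n n<k))

binomial-diag : ∀ n → binomial n n ≡ 1
binomial-diag zero    = refl
binomial-diag (suc n) = cong₂ _+_ (binomial-diag n) (binomial-< n (suc n) ≤-refl)

binomial-suc-diag : ∀ n → binomial (suc n) n ≡ suc n
binomial-suc-diag zero    = refl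
binomial-suc-diag (suc n) = trans (cong₂ _+_ (binomial-suc-diag n) (binomial-diag (suc n))) (+-comm (suc n) 1)

binomial-pos : ∀ n k → k ≤ n → 1 ≤ binomial n k
binomial-pos n       zero    _         = ≤-refl
binomial-pos (suc n) (suc k) (s≤s k≤n) = ≤-trans (binomial-pos n k k≤n) (m≤m+n _ _)

binomial-monoˡ : ∀ {n n′} k → n ≤ n′ → binomial n k ≤ binomial n′ k
binomial-monoˡ                 zero    _          = ≤-refl
binomial-monoˡ {zero}          (suc k) _          = z≤n
binomial-monoˡ {suc n} {suc n′} (suc k) (s≤s n≤n′) =
  +-mono-≤ (binomial-monoˡ k n≤n′) (binomial-monoˡ (suc k) n≤n′)

binomial≤^ : ∀ n k → binomial n k ≤ n ^ k
binomial≤^ n       zero    = ≤-refl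
binomial≤^ zero    (suc k) = z≤n
binomial≤^ (suc n) (suc k) = begin
  binomial n k + binomial n (suc k)  ≤⟨ +-mono-≤ (binomial≤^ n k) (binomial≤^ n (suc k)) ⟩
  n ^ k + n * n ^ k                  ≤⟨ +-mono-≤ (^-monoˡ-≤ k (n≤1+n n)) (*-monoʳ-≤ n (^-monoˡ-≤ k (n≤1+n n))) ⟩
  suc n ^ suc k                      ∎
  where open ≤-Reasoning

binomial[2+n,n]-excess : ∀ n → 1 ≤ n → Σ ℕ λ δ → 1 ≤ δ × binomial (2 + n) n ≡ suc n + δ
binomial[2+n,n]-excess (suc n) _ =
  δ , binomial-pos (2 + n) n (m≤n+m n 2) , trans (cong (δ +_) (binomial-suc-diag (suc n))) (+-comm δ _)
  where δ = binomial (2 + n) n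

∑ˡ-subsets-⊆ : ∀ m (P : Subset m) t →
  ∑ˡ (λ S → 𝟙 ((∣ S ∣ ≡ᵇ t) ∧ subsetᵇ S P)) (allSubsets m) ≡ binomial ∣ P ∣ t
∑ˡ-subsets-⊆ zero    P zero    = refl
∑ˡ-subsets-⊆ zero    P (suc t) = refl
∑ˡ-subsets-⊆ (suc m) P t = trans (∑ˡ-map-++-map _ _ _ (allSubsets m)) (by-first-row t (P zero) refl)
  where
  P′ : Subset m
  P′ = P ∘ suc
  subsets : List (Subset m)
  subsets = allSubsets m
  by-first-row : ∀ t b → P zero ≡ b →
    ∑ˡ (λ S → 𝟙 ((∣ S ∣ ≡ᵇ t) ∧ subsetᵇ S P′)) subsets +
    ∑ˡ (λ S → 𝟙 ((suc ∣ S ∣ ≡ᵇ t) ∧ (P zero ∧ subsetᵇ S P′))) subsets ≡ binomial ∣ P ∣ t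
  by-first-row zero b _ =
    trans (cong₂ _+_ (∑ˡ-subsets-⊆ m P′ zero) (∑ˡ-zero subsets (λ _ → refl))) refl
  by-first-row (suc t) true  P0 rewrite P0 =
    trans (cong₂ _+_ (∑ˡ-subsets-⊆ m P′ (suc t)) (∑ˡ-subsets-⊆ m P′ t)) (+-comm (binomial ∣ P′ ∣ (suc t)) _)
  by-first-row (suc t) false P0 rewrite P0 =
    trans (cong₂ _+_ (∑ˡ-subsets-⊆ m P′ (suc t)) (∑ˡ-zero subsets λ S → cong 𝟙 (∧-zeroʳ (suc ∣ S ∣ ≡ᵇ suc t))))
          (+-identityʳ _)

∑ˡ-subsets-size : ∀ m t → ∑ˡ (λ S → 𝟙 (∣ S ∣ ≡ᵇ t)) (allSubsets m) ≡ binomial m t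
∑ˡ-subsets-size m t = begin
  ∑ˡ (λ S → 𝟙 (∣ S ∣ ≡ᵇ t)) (allSubsets m)                          ≡⟨ ∑ˡ-cong (allSubsets m) ⊆-full ⟩
  ∑ˡ (λ S → 𝟙 ((∣ S ∣ ≡ᵇ t) ∧ subsetᵇ S full)) (allSubsets m)        ≡⟨ ∑ˡ-subsets-⊆ m full t ⟩
  binomial ∣ full ∣ t                                               ≡⟨ cong (λ x → binomial x t) (countF-true m) ⟩
  binomial m t                                                      ∎
  where
  open ≡-Reasoning
  full : Subset m
  full _ = true
  ⊆-full : ∀ S → 𝟙 (∣ S ∣ ≡ᵇ t) ≡ 𝟙 ((∣ S ∣ ≡ᵇ t) ∧ subsetᵇ S full)
  ⊆-full S = cong 𝟙 (sym (trans (cong ((∣ S ∣ ≡ᵇ t) ∧_) (⇒subsetᵇ-true {S = S} {full} (λ _ _ → refl))) (∧-identityʳ _)))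

∑ˡ-sameSet : ∀ m (U : Subset m) → ∑ˡ (λ S → 𝟙 (sameSet S U)) (allSubsets m) ≡ 1
∑ˡ-sameSet zero    U = refl
∑ˡ-sameSet (suc m) U = trans (∑ˡ-map-++-map _ _ _ (allSubsets m)) (by-first-row (U zero) refl)
  where
  U′ : Subset m
  U′ = U ∘ suc
  subsets : List (Subset m)
  subsets = allSubsets m
  by-first-row : ∀ b → U zero ≡ b →
    ∑ˡ (λ S → 𝟙 (not (U zero) ∧ sameSet S U′)) subsets + ∑ˡ (λ S → 𝟙 (U zero ∧ sameSet S U′)) subsets ≡ 1
  by-first-row true  U0 rewrite U0 =
    trans (cong (_+ ∑ˡ (λ S → 𝟙 (sameSet S U′)) subsets) (∑ˡ-zero subsets (λ _ → refl))) (∑ˡ-sameSet m U′)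
  by-first-row false U0 rewrite U0 =
    trans (cong (∑ˡ (λ S → 𝟙 (sameSet S U′)) subsets +_) (∑ˡ-zero subsets (λ _ → refl)))
          (trans (+-identityʳ _) (∑ˡ-sameSet m U′))

⊆-∣∣-≥⇒≡ : ∀ (S U : Subset m) → (∀ i → S i ≡ true → U i ≡ true) → ∣ U ∣ ≤ ∣ S ∣ → ∀ i → S i ≡ U i
⊆-∣∣-≥⇒≡ {suc m} S U S⊆U ∣U∣≤∣S∣ zero    = heads
  where
  heads : S zero ≡ U zero
  heads with S zero in S0 | U zero in U0
  ... | true  | true  = refl
  ... | false | false = refl
  ... | true  | false = ⊥-elim (false≢true (trans (sym U0) (S⊆U zero S0)))
  ... | false | true  = ⊥-elim (1+n≰n (≤-trans (s≤s (countF-mono (S⊆U ∘ suc))) ∣U∣≤∣S∣))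
⊆-∣∣-≥⇒≡ {suc m} S U S⊆U ∣U∣≤∣S∣ (suc i) = ⊆-∣∣-≥⇒≡ (S ∘ suc) (U ∘ suc) (S⊆U ∘ suc) tails i
  where
  tails : ∣ U ∘ suc ∣ ≤ ∣ S ∘ suc ∣
  tails = +-cancelˡ-≤ (𝟙 (S zero)) _ _
    (subst (λ b → 𝟙 b + ∣ U ∘ suc ∣ ≤ ∣ S ∣) (sym (⊆-∣∣-≥⇒≡ S U S⊆U ∣U∣≤∣S∣ zero)) ∣U∣≤∣S∣)

enumerate-beyond : ∀ (p : Fin n → Bool) k → ¬ (countF p ≤ suc k) →
  Σ (Fin (k + 2) → Fin n) λ f → Injective _≡_ _≡_ f × (∀ i → p (f i) ≡ true)
enumerate-beyond p k c≰1+k = enumerate p (k + 2) (subst (_≤ countF p) (+-comm 2 k) (≰⇒> c≰1+k))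

prefix : Subset m → ℕ → Subset m
prefix {suc m} S zero    i       = false
prefix {suc m} S (suc k) zero    = S zero
prefix {suc m} S (suc k) (suc i) = prefix (S ∘ suc) (if S zero then k else suc k) i

prefix-⊆ : ∀ (S : Subset m) k i → prefix S k i ≡ true → S i ≡ true
prefix-⊆ {suc m} S (suc k) zero    e = e
prefix-⊆ {suc m} S (suc k) (suc i) e = prefix-⊆ (S ∘ suc) _ i e

∣prefix∣ : ∀ (S : Subset m) k → ∣ prefix S k ∣ ≡ ∣ S ∣ ⊓ k
∣prefix∣ {zero}  S k       = refl
∣prefix∣ {suc m} S zero    = trans (countF-false m) (sym (⊓-zeroʳ ∣ S ∣))
∣prefix∣ {suc m} S (suc k) with S zero
... | true  = cong suc (∣prefix∣ (S ∘ suc) k)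
... | false = ∣prefix∣ (S ∘ suc) (suc k)

prefix-all : ∀ (S : Subset m) k → ∣ S ∣ ≤ k → ∀ i → prefix S k i ≡ S i
prefix-all {suc m} S zero    ∣S∣≤0 i = sym (countF≤0⇒ S ∣S∣≤0 i)
prefix-all {suc m} S (suc k) _     zero = refl
prefix-all {suc m} S (suc k) ∣S∣≤k (suc i) with S zero
... | true  = prefix-all (S ∘ suc) k (≤-pred ∣S∣≤k) i
... | false = prefix-all (S ∘ suc) (suc k) ∣S∣≤k i

prefix-precedes : ∀ (S : Subset m) k p r → prefix S k p ≡ true → S r ≡ true → prefix S k r ≡ false → toℕ p < toℕ r
prefix-precedes {suc m} S (suc k) zero    zero    _ Sr ¬Sr = ⊥-elim (false≢true (trans (sym ¬Sr) Sr))
prefix-precedes {suc m} S (suc k) zero    (suc r) _ _  _   = s≤s z≤n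
prefix-precedes {suc m} S (suc k) (suc p) zero    _ Sr ¬Sr = ⊥-elim (false≢true (trans (sym ¬Sr) Sr))
prefix-precedes {suc m} S (suc k) (suc p) (suc r) e Sr ¬Sr = s≤s (prefix-precedes (S ∘ suc) _ p r e Sr ¬Sr)

-- Finding the configuration q · 1_t 0_ℓ

onesZeros-splitAt : ∀ t ℓ (i : Fin (t + ℓ)) →
  onesZeros t ℓ i ≡ [ (λ _ → true) , (λ _ → false) ]′ (splitAt t i)
onesZeros-splitAt zero    ℓ i       = refl
onesZeros-splitAt (suc t) ℓ zero    = refl
onesZeros-splitAt (suc t) ℓ (suc i) = trans (onesZeros-splitAt t ℓ i) (sym ([,]-map (splitAt t i)))

-- The column σ i₀ is only there to force S and T to be disjoint.
≺-from-rows : ∀ {m n t ℓ q} (A : Matrix m n) (S T : Subset m) → t ≤ ∣ S ∣ → ℓ ≤ ∣ T ∣ →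
  (σ : Fin q → Fin n) → Injective _≡_ _≡_ σ → Fin q →
  (∀ i r → S r ≡ true → A r (σ i) ≡ true) → (∀ i r → T r ≡ true → A r (σ i) ≡ false) →
  copies q (onesZeros t ℓ) ≺ A
≺-from-rows {m} {n} {t} {ℓ} {q} A S T t≤∣S∣ ℓ≤∣T∣ σ σ-inj i₀ ones zeros = ρ , σ , ρ-inj , σ-inj , entries
  where
  fS : Fin t → Fin m
  fS = proj₁ (enumerate S t t≤∣S∣)
  fS-inj : Injective _≡_ _≡_ fS
  fS-inj = proj₁ (proj₂ (enumerate S t t≤∣S∣))
  fS-ok : ∀ a → S (fS a) ≡ true
  fS-ok = proj₂ (proj₂ (enumerate S t t≤∣S∣))
  fT : Fin ℓ → Fin m
  fT = proj₁ (enumerate T ℓ ℓ≤∣T∣)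
  fT-inj : Injective _≡_ _≡_ fT
  fT-inj = proj₁ (proj₂ (enumerate T ℓ ℓ≤∣T∣))
  fT-ok : ∀ b → T (fT b) ≡ true
  fT-ok = proj₂ (proj₂ (enumerate T ℓ ℓ≤∣T∣))
  ρ : Fin (t + ℓ) → Fin m
  ρ i = [ fS , fT ]′ (splitAt t i)
  disjoint : ∀ a b → fS a ≢ fT b
  disjoint a b e = false≢true (trans (sym (zeros i₀ (fT b) (fT-ok b)))
                                     (subst (λ r → A r (σ i₀) ≡ true) e (ones i₀ (fS a) (fS-ok a))))
  [fS,fT]-inj : ∀ u v → [ fS , fT ]′ u ≡ [ fS , fT ]′ v → u ≡ v
  [fS,fT]-inj (inj₁ a) (inj₁ b) e = cong inj₁ (fS-inj e)
  [fS,fT]-inj (inj₂ a) (inj₂ b) e = cong inj₂ (fT-inj e)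
  [fS,fT]-inj (inj₁ a) (inj₂ b) e = ⊥-elim (disjoint a b e)
  [fS,fT]-inj (inj₂ a) (inj₁ b) e = ⊥-elim (disjoint b a (sym e))
  ρ-inj : Injective _≡_ _≡_ ρ
  ρ-inj {x} {y} e = begin
    x                       ≡⟨ join-splitAt t ℓ x ⟨
    join t ℓ (splitAt t x)  ≡⟨ cong (join t ℓ) ([fS,fT]-inj (splitAt t x) (splitAt t y) e) ⟩
    join t ℓ (splitAt t y)  ≡⟨ join-splitAt t ℓ y ⟩
    y                       ∎
    where open ≡-Reasoning
  entries : ∀ i j → A (ρ i) (σ j) ≡ copies q (onesZeros t ℓ) i j
  entries i j = trans (entry (splitAt t i)) (sym (onesZeros-splitAt t ℓ i))
    where
    entry : ∀ u → A ([ fS , fT ]′ u) (σ j) ≡ [ (λ _ → true) , (λ _ → false) ]′ u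
    entry (inj₁ a) = ones j (fS a) (fS-ok a)
    entry (inj₂ b) = zeros j (fT b) (fT-ok b)

far-weight-arithmetic : ∀ t λ' m₁ N d L y → 1 ≤ t → N ≤ suc λ' → m₁ ≤ 1 → N ≡ m₁ + d + L →
  (m₁ ≡ 1 → d ≡ λ' → y ≡ 1) → 1 + (t * m₁ + N) ≤ y + (suc t + λ') + L
far-weight-arithmetic t λ' m₁ N d (suc L) y _ N≤1+λ' m₁≤1 _ _ = begin
  1 + (t * m₁ + N)        ≤⟨ s≤s (+-mono-≤ (≤-trans (*-monoʳ-≤ t m₁≤1) (≤-reflexive (*-identityʳ t))) N≤1+λ') ⟩
  1 + (t + suc λ')        ≡⟨ cong suc (+-suc t λ') ⟩
  1 + (suc t + λ')        ≡⟨ +-comm 1 (suc t + λ') ⟩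
  (suc t + λ') + 1        ≤⟨ +-mono-≤ (m≤n+m (suc t + λ') y) (s≤s z≤n) ⟩
  y + (suc t + λ') + suc L ∎
  where open ≤-Reasoning
far-weight-arithmetic t λ' zero N d zero y 1≤t N≤1+λ' _ _ _ = begin
  1 + (t * 0 + N)         ≡⟨ cong (λ x → 1 + (x + N)) (*-zeroʳ t) ⟩
  suc N                   ≤⟨ +-mono-≤ 1≤t N≤1+λ' ⟩
  t + suc λ'              ≡⟨ +-suc t λ' ⟩
  suc t + λ'              ≤⟨ m≤n+m (suc t + λ') y ⟩
  y + (suc t + λ')        ≡⟨ +-identityʳ _ ⟨
  y + (suc t + λ') + 0    ∎
  where open ≤-Reasoning
far-weight-arithmetic t λ' (suc zero) N d zero y _ N≤1+λ' _ N≡ y≡1 with d ≟ λ'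
... | yes d≡λ' rewrite y≡1 refl d≡λ' = begin
  1 + (t * 1 + N)         ≤⟨ s≤s (+-mono-≤ (≤-reflexive (*-identityʳ t)) N≤1+λ') ⟩
  1 + (t + suc λ')        ≡⟨ cong suc (+-suc t λ') ⟩
  1 + (suc t + λ')        ≡⟨ +-identityʳ _ ⟨
  1 + (suc t + λ') + 0    ∎
  where open ≤-Reasoning
... | no d≢λ' = begin
  1 + (t * 1 + N)         ≤⟨ s≤s (+-mono-≤ (≤-reflexive (*-identityʳ t)) N≤λ') ⟩
  1 + (t + λ')            ≤⟨ m≤n+m _ y ⟩
  y + (suc t + λ')        ≡⟨ +-identityʳ _ ⟨
  y + (suc t + λ') + 0    ∎
  where
  open ≤-Reasoning
  N≡1+d : N ≡ suc d
  N≡1+d = trans N≡ (cong suc (+-identityʳ d))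
  N≤λ' : N ≤ λ'
  N≤λ' = subst (_≤ λ') (sym N≡1+d) (≤∧≢⇒< (≤-pred (subst (_≤ suc λ') N≡1+d N≤1+λ')) d≢λ')
far-weight-arithmetic t λ' (suc (suc m₁)) N d zero y _ _ (s≤s ()) _ _

excess-bound : ∀ a b c δ x → 1 ≤ δ → b < a → a + δ * c ≤ b + x → c ≤ x
excess-bound a b c δ x 1≤δ b<a a+δc≤b+x = begin
  c          ≡⟨ *-identityˡ c ⟨
  1 * c      ≤⟨ *-monoˡ-≤ c 1≤δ ⟩
  δ * c      <⟨ +-cancelˡ-< a (δ * c) x (≤-<-trans a+δc≤b+x (+-monoˡ-< x b<a)) ⟩
  x          ∎
  where open ≤-Reasoning

cancel-bound : ∀ N a b c δ s y z → b < a → N + (a + δ * c) ≤ y + b + (s + δ) * c + z → N < y + s * c + z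
cancel-bound N a b c δ s y z b<a le =
  +-cancelʳ-< a N (y + s * c + z) (≤-<-trans N+a≤ (+-monoʳ-< (y + s * c + z) b<a))
  where
  regroupˡ : ∀ N a δ c → N + (a + δ * c) ≡ N + a + δ * c
  regroupˡ = solve-∀
  regroupʳ : ∀ y b s δ c z → y + b + (s + δ) * c + z ≡ y + s * c + z + b + δ * c
  regroupʳ = solve-∀
  N+a≤ : N + a ≤ y + s * c + z + b
  N+a≤ = +-cancelʳ-≤ (δ * c) _ _ (subst₂ _≤_ (regroupˡ N a δ c) (regroupʳ y b s δ c z) le)

error-term-bound : ∀ y s x e → 1 ≤ e → y + s * (x * e) + x * suc e ≤ y + suc (suc s) * (x * e)
error-term-bound y s x e 1≤e = begin
  y + s * (x * e) + x * suc e           ≡⟨ regroup y s x e ⟩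
  x + (y + suc s * (x * e))             ≤⟨ +-monoˡ-≤ _ (≤-trans (≤-reflexive (sym (*-identityʳ x))) (*-monoʳ-≤ x 1≤e)) ⟩
  x * e + (y + suc s * (x * e))         ≡⟨ regroup′ y s x e ⟩
  y + suc (suc s) * (x * e)             ∎
  where
  open ≤-Reasoning
  regroup : ∀ y s x e → y + s * (x * e) + x * suc e ≡ x + (y + suc s * (x * e))
  regroup = solve-∀
  regroup′ : ∀ y s x e → x * e + (y + suc s * (x * e)) ≡ y + suc (suc s) * (x * e)
  regroup′ = solve-∀

-- The double counting

module Counting (t ℓ λ' : ℕ) (ℓ<t : ℓ < t) {m n : ℕ} (ℓ≤m : ℓ ≤ m) (A : Matrix m n)
  (≺-free : ¬ (copies (λ' + 2) (onesZeros t ℓ) ≺ A))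
  (sums-in-range : ∀ j → t ≤ colSum A j × colSum A j ≤ m ∸ ℓ)
  (simple : ∀ j j′ → colSum A j ≡ t → colSum A j′ ≡ t → (∀ i → A i j ≡ A i j′) → j ≡ j′)
  where

  1≤t : 1 ≤ t
  1≤t = ≤-trans (s≤s z≤n) ℓ<t

  subsets : List (Subset m)
  subsets = allSubsets m

  sizeT : Subset m → Bool
  sizeT S = ∣ S ∣ ≡ᵇ t

  colT colT₊₁ colLarge : Fin n → Bool
  colT     j = colSum A j ≡ᵇ t
  colT₊₁   j = colSum A j ≡ᵇ suc t
  colLarge j = 2 + t ≤ᵇ colSum A j

  data Kind (j : Fin n) : Set where
    sum-t    : colSum A j ≡ t     → colT j ≡ true  → colT₊₁ j ≡ false → colLarge j ≡ false → Kind j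
    sum-t+1  : colSum A j ≡ suc t → colT j ≡ false → colT₊₁ j ≡ true  → colLarge j ≡ false → Kind j
    sum-≥t+2 : 2 + t ≤ colSum A j → colT j ≡ false → colT₊₁ j ≡ false → colLarge j ≡ true  → Kind j

  kind : ∀ j → Kind j
  kind j with colSum A j ≟ t
  ... | yes e = sum-t e (⇒≡ᵇ-true e)
    (≢true⇒≡false λ q → 1+n≰n (≤-reflexive (trans (sym (≡ᵇ-true⇒ q)) e)))
    (≢true⇒≡false λ q → 1+n≰n (≤-trans (n≤1+n _) (subst (2 + t ≤_) e (≤ᵇ-true⇒ q))))
  ... | no ≢t with colSum A j ≟ suc t
  ...   | yes e = sum-t+1 e (≢true⇒≡false (≢t ∘ ≡ᵇ-true⇒)) (⇒≡ᵇ-true e)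
    (≢true⇒≡false λ q → 1+n≰n (subst (2 + t ≤_) e (≤ᵇ-true⇒ q)))
  ...   | no ≢t+1 = sum-≥t+2 large (≢true⇒≡false (≢t ∘ ≡ᵇ-true⇒)) (≢true⇒≡false (≢t+1 ∘ ≡ᵇ-true⇒))
    (⇒≤ᵇ-true large)
    where
    large : 2 + t ≤ colSum A j
    large = ≤∧≢⇒< (≤∧≢⇒< (proj₁ (sums-in-range j)) (≢t ∘ sym)) (≢t+1 ∘ sym)

  top : Fin n → Subset m
  top j = prefix (I A j) (2 + t)

  ∣top∣ : ∀ j → ∣ top j ∣ ≡ colSum A j ⊓ (2 + t)
  ∣top∣ j = ∣prefix∣ (I A j) (2 + t)

  top≡column : ∀ j → colSum A j ≤ 2 + t → ∀ i → top j i ≡ A i j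
  top≡column j ≤2+t = prefix-all (I A j) (2 + t) ≤2+t

  covers : Subset m → Fin n → Bool
  covers S j = sizeT S ∧ subsetᵇ S (top j)

  covers⇒ones : ∀ S j → covers S j ≡ true → ∀ r → S r ≡ true → A r j ≡ true
  covers⇒ones S j e r Sr = prefix-⊆ (I A j) (2 + t) r (subsetᵇ-true⇒ S (top j) (proj₂ (∧-true⇒ e)) r Sr)

  #covers #coversT #coversT₊₁ #coversLarge weight : Subset m → ℕ
  #covers     S = countF (covers S)
  #coversT    S = countF (λ j → colT j ∧ covers S j)
  #coversT₊₁  S = countF (λ j → colT₊₁ j ∧ covers S j)
  #coversLarge S = countF (λ j → colLarge j ∧ covers S j)
  weight      S = t * #coversT S + #covers S

  contribution : Subset m → Fin n → ℕ
  contribution S j = t * 𝟙 (colT j ∧ covers S j) + 𝟙 (covers S j)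

  #covers-split : ∀ S → #covers S ≡ #coversT S + #coversT₊₁ S + #coversLarge S
  #covers-split S = begin
    countF (covers S)
      ≡⟨ countF≡sum (covers S) ⟩
    sum (λ j → 𝟙 (covers S j))
      ≡⟨ sum-cong-≗ by-kind ⟩
    sum (λ j → 𝟙 (Q j) + 𝟙 (Q₊₁ j) + 𝟙 (Q₊ j))
      ≡⟨ ∑-distrib-+ (λ j → 𝟙 (Q j) + 𝟙 (Q₊₁ j)) (𝟙 ∘ Q₊) ⟩
    sum (λ j → 𝟙 (Q j) + 𝟙 (Q₊₁ j)) + sum (𝟙 ∘ Q₊)
      ≡⟨ cong (_+ sum (𝟙 ∘ Q₊)) (∑-distrib-+ (𝟙 ∘ Q) (𝟙 ∘ Q₊₁)) ⟩
    sum (𝟙 ∘ Q) + sum (𝟙 ∘ Q₊₁) + sum (𝟙 ∘ Q₊)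
      ≡⟨ cong₂ _+_ (cong₂ _+_ (countF≡sum Q) (countF≡sum Q₊₁)) (countF≡sum Q₊) ⟨
    #coversT S + #coversT₊₁ S + #coversLarge S
      ∎
    where
    open ≡-Reasoning
    Q Q₊₁ Q₊ : Fin n → Bool
    Q   j = colT j ∧ covers S j
    Q₊₁ j = colT₊₁ j ∧ covers S j
    Q₊  j = colLarge j ∧ covers S j
    by-kind : ∀ j → 𝟙 (covers S j) ≡ 𝟙 (Q j) + 𝟙 (Q₊₁ j) + 𝟙 (Q₊ j)
    by-kind j with kind j
    ... | sum-t    _ a b c rewrite a | b | c = sym (trans (+-identityʳ _) (+-identityʳ _))
    ... | sum-t+1  _ a b c rewrite a | b | c = sym (+-identityʳ _)
    ... | sum-≥t+2 _ a b c rewrite a | b | c = refl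

  covers-sum-t⇒≡ : ∀ S j → sizeT S ≡ true → colSum A j ≡ t → subsetᵇ S (top j) ≡ true → ∀ i → S i ≡ A i j
  covers-sum-t⇒≡ S j ∣S∣≡t sum≡t S⊆top = ⊆-∣∣-≥⇒≡ S (I A j)
    (λ r Sr → prefix-⊆ (I A j) (2 + t) r (subsetᵇ-true⇒ S (top j) S⊆top r Sr))
    (≤-reflexive (trans sum≡t (sym (≡ᵇ-true⇒ ∣S∣≡t))))

  #coversT≤1 : ∀ S → #coversT S ≤ 1
  #coversT≤1 S = countF≤1 (λ j → colT j ∧ covers S j) same-column
    where
    same-column : ∀ j j′ → (colT j ∧ covers S j) ≡ true → (colT j′ ∧ covers S j′) ≡ true → j ≡ j′
    same-column j j′ e e′ =
      let a  , b  = ∧-true⇒ e ; a′ , b′ = ∧-true⇒ e′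
          sz , s  = ∧-true⇒ b ; _  , s′ = ∧-true⇒ b′
      in simple j j′ (≡ᵇ-true⇒ a) (≡ᵇ-true⇒ a′)
           (λ i → trans (sym (covers-sum-t⇒≡ S j sz (≡ᵇ-true⇒ a) s i)) (covers-sum-t⇒≡ S j′ sz (≡ᵇ-true⇒ a′) s′ i))

  1≤#coversT⇒μ≡1 : ∀ S → sizeT S ≡ true → 1 ≤ #coversT S → μ t A S ≡ 1
  1≤#coversT⇒μ≡1 S ∣S∣≡t 1≤# =
    let j , q = 1≤countF⇒ (λ j → colT j ∧ covers S j) 1≤#
        a , b = ∧-true⇒ q
    in cong 𝟙 (⇒anyF-true j (⇒∧-true a
         (⇒sameSet-true (covers-sum-t⇒≡ S j ∣S∣≡t (≡ᵇ-true⇒ a) (proj₂ (∧-true⇒ b))))))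

  #coversT₊₁≡d : ∀ S → sizeT S ≡ true → #coversT₊₁ S ≡ d t A S
  #coversT₊₁≡d S ∣S∣≡t = countF-cong same
    where
    same : ∀ j → (colT₊₁ j ∧ covers S j) ≡ ((colSum A j ≡ᵇ suc t) ∧ subsetᵇ S (I A j))
    same j with colSum A j ≡ᵇ suc t in e
    ... | false = refl
    ... | true rewrite ∣S∣≡t = subsetᵇ-congʳ S (top≡column j (≤-trans (≤-reflexive (≡ᵇ-true⇒ e)) (n≤1+n _)))

  M₀ : ℕ
  M₀ = ℓ + (λ' + 2) * (2 + t)

  far : Subset m → Bool
  far S = anyF (λ i → S i ∧ (M₀ ≤ᵇ toℕ i))

  low : Subset m
  low i = toℕ i <ᵇ M₀

  few-columns : ∀ (S T : Subset m) (Q : Fin n → Bool) → t ≤ ∣ S ∣ → ℓ ≤ ∣ T ∣ →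
    (∀ j → Q j ≡ true → ∀ r → S r ≡ true → A r j ≡ true) →
    (∀ j → Q j ≡ true → ∀ r → T r ≡ true → A r j ≡ false) → countF Q ≤ suc λ'
  few-columns S T Q t≤∣S∣ ℓ≤∣T∣ ones zeros with countF Q ≤? suc λ'
  ... | yes few  = few
  ... | no  many = let σ , σ-inj , σ-ok = enumerate-beyond Q λ' many in
    ⊥-elim (≺-free (≺-from-rows A S T t≤∣S∣ ℓ≤∣T∣ σ σ-inj (λ' ↑ʳ zero)
                     (λ i → ones (σ i) (σ-ok i)) (λ i → zeros (σ i) (σ-ok i))))

  -- T consists of the rows above p outside the tops of the columns σ i.  As p lies
  -- in each of these tops, the columns σ i vanish on T, and ∣ T ∣ ≥ p − (λ' + 2)(t + 2) ≥ ℓ.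
  ≺-from-far-element : ∀ S → sizeT S ≡ true → (p : Fin m) → S p ≡ true → M₀ ≤ toℕ p →
    (σ : Fin (λ' + 2) → Fin n) → Injective _≡_ _≡_ σ → (∀ i → covers S (σ i) ≡ true) →
    copies (λ' + 2) (onesZeros t ℓ) ≺ A
  ≺-from-far-element S ∣S∣≡t p Sp M₀≤p σ σ-inj σ-ok =
    ≺-from-rows A S T (≤-reflexive (sym (≡ᵇ-true⇒ ∣S∣≡t))) ℓ≤∣T∣ σ σ-inj (λ' ↑ʳ zero) ones zeros
    where
    T : Subset m
    T r = (toℕ r <ᵇ toℕ p) ∧ allF (λ i → not (top (σ i) r))
    ones : ∀ i r → S r ≡ true → A r (σ i) ≡ true
    ones i = covers⇒ones S (σ i) (σ-ok i)
    zeros : ∀ i r → T r ≡ true → A r (σ i) ≡ false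
    zeros i r Tr = ≢true⇒≡false λ Ar →
      <-asym (<ᵇ-true⇒ (proj₁ (∧-true⇒ Tr)))
             (prefix-precedes (I A (σ i)) (2 + t) p r
               (subsetᵇ-true⇒ S (top (σ i)) (proj₂ (∧-true⇒ (σ-ok i))) p Sp) Ar
               (not-true⇒ (allF-true⇒ (proj₂ (∧-true⇒ Tr)) i)))
    ∣top∣≤ : ∀ i → ∣ top (σ i) ∣ ≤ 2 + t
    ∣top∣≤ i = ≤-trans (≤-reflexive (∣top∣ (σ i))) (m⊓n≤n _ _)
    p≤∣T∣+ : toℕ p ≤ ∣ T ∣ + (λ' + 2) * (2 + t)
    p≤∣T∣+ = begin
      toℕ p                                   ≡⟨ m≥n⇒m⊓n≡n (<⇒≤ (toℕ<n p)) ⟨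
      m ⊓ toℕ p                               ≡⟨ countF-<ᵇ m (toℕ p) ⟨
      countF {m} (λ r → toℕ r <ᵇ toℕ p)       ≤⟨ countF-union-bound (λ r → toℕ r <ᵇ toℕ p) (top ∘ σ) ⟩
      ∣ T ∣ + sum (λ i → ∣ top (σ i) ∣)      ≤⟨ +-monoʳ-≤ ∣ T ∣ (sum-mono-≤ ∣top∣≤) ⟩
      ∣ T ∣ + sum {λ' + 2} (λ _ → 2 + t)     ≡⟨ cong (∣ T ∣ +_) (sum-const (λ' + 2) (2 + t)) ⟩
      ∣ T ∣ + (λ' + 2) * (2 + t)              ∎
      where open ≤-Reasoning
    ℓ≤∣T∣ : ℓ ≤ ∣ T ∣
    ℓ≤∣T∣ = +-cancelʳ-≤ ((λ' + 2) * (2 + t)) ℓ ∣ T ∣ (≤-trans M₀≤p p≤∣T∣+)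

  #covers-far : ∀ S → sizeT S ≡ true → far S ≡ true → #covers S ≤ suc λ'
  #covers-far S ∣S∣≡t far-S with #covers S ≤? suc λ'
  ... | yes few  = few
  ... | no  many =
    let σ , σ-inj , σ-ok = enumerate-beyond (covers S) λ' many
        p , Sp∧M₀≤p      = anyF-true⇒ {p = λ i → S i ∧ (M₀ ≤ᵇ toℕ i)} far-S
        Sp , M₀≤p        = ∧-true⇒ Sp∧M₀≤p
    in ⊥-elim (≺-free (≺-from-far-element S ∣S∣≡t p Sp (≤ᵇ-true⇒ M₀≤p) σ σ-inj σ-ok))

  ¬far⇒⊆low : ∀ S → far S ≡ false → subsetᵇ S low ≡ true
  ¬far⇒⊆low S ¬far = ⇒subsetᵇ-true {S = S} {low} λ i Si →
    ⇒<ᵇ-true (≤ᵇ-false⇒ {M₀} (subst (λ b → b ∧ (M₀ ≤ᵇ toℕ i) ≡ false) Si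
                                     (anyF-false⇒ {p = λ i → S i ∧ (M₀ ≤ᵇ toℕ i)} ¬far i)))

  zeros-of : Fin n → Subset m
  zeros-of j = prefix (λ r → not (A r j)) ℓ

  ∣zeros-of∣ : ∀ j → ∣ zeros-of j ∣ ≡ ℓ
  ∣zeros-of∣ j = trans (∣prefix∣ (λ r → not (A r j)) ℓ) (m≥n⇒m⊓n≡n ℓ≤#zeros)
    where
    ℓ≤#zeros : ℓ ≤ countF (λ r → not (A r j))
    ℓ≤#zeros = +-cancelˡ-≤ (colSum A j) ℓ _ (begin
      colSum A j + ℓ                                ≤⟨ +-monoˡ-≤ ℓ (proj₂ (sums-in-range j)) ⟩
      m ∸ ℓ + ℓ                                     ≡⟨ m∸n+n≡m ℓ≤m ⟩
      m                                             ≡⟨ countF-complement (I A j) ⟨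
      colSum A j + countF (λ r → not (A r j))       ∎)
      where open ≤-Reasoning

  sizeℓ : Subset m → Bool
  sizeℓ T = ∣ T ∣ ≡ᵇ ℓ

  ∑ˡ-zeros-of : ∀ j → ∑ˡ (λ T → 𝟙 (sizeℓ T ∧ sameSet T (zeros-of j))) subsets ≡ 1
  ∑ˡ-zeros-of j = trans (∑ˡ-cong subsets drop-size) (∑ˡ-sameSet m (zeros-of j))
    where
    drop-size : ∀ T → 𝟙 (sizeℓ T ∧ sameSet T (zeros-of j)) ≡ 𝟙 (sameSet T (zeros-of j))
    drop-size T with sameSet T (zeros-of j) in e
    ... | false = cong 𝟙 (∧-zeroʳ (sizeℓ T))
    ... | true rewrite ⇒≡ᵇ-true (trans (countF-cong (sameSet-true⇒ T (zeros-of j) e)) (∣zeros-of∣ j)) = refl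

  -- Pigeonhole over the ℓ-sets zeros-of j: each fibre has at most λ' + 1 columns.
  #columns-⊇ : ∀ S → sizeT S ≡ true → (Q : Fin n → Bool) →
    (∀ j → Q j ≡ true → ∀ r → S r ≡ true → A r j ≡ true) → countF Q ≤ suc λ' * binomial m ℓ
  #columns-⊇ S ∣S∣≡t Q ones = begin
    countF Q                                              ≡⟨ countF≡sum Q ⟩
    sum (λ j → 𝟙 (Q j))                                   ≡⟨ sum-cong-≗ one-key ⟩
    sum (λ j → 𝟙 (Q j) * ∑ˡ (λ T → 𝟙 (key j T)) subsets)  ≡⟨ sum-cong-≗ (λ j → into-sum j) ⟩
    sum (λ j → ∑ˡ (λ T → 𝟙 (Q j ∧ key j T)) subsets)      ≡⟨ ∑ˡ-sum-comm (λ T j → 𝟙 (Q j ∧ key j T)) subsets ⟨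
    ∑ˡ (λ T → sum (λ j → 𝟙 (Q j ∧ key j T))) subsets      ≤⟨ ∑ˡ-mono-≤ subsets fibre ⟩
    ∑ˡ (λ T → suc λ' * 𝟙 (sizeℓ T)) subsets               ≡⟨ ∑ˡ-distribˡ-* (suc λ') (𝟙 ∘ sizeℓ) subsets ⟩
    suc λ' * ∑ˡ (𝟙 ∘ sizeℓ) subsets                       ≡⟨ cong (suc λ' *_) (∑ˡ-subsets-size m ℓ) ⟩
    suc λ' * binomial m ℓ                                 ∎
    where
    open ≤-Reasoning
    key : Fin n → Subset m → Bool
    key j T = sizeℓ T ∧ sameSet T (zeros-of j)
    one-key : ∀ j → 𝟙 (Q j) ≡ 𝟙 (Q j) * ∑ˡ (λ T → 𝟙 (key j T)) subsets
    one-key j = trans (sym (*-identityʳ _)) (cong (𝟙 (Q j) *_) (sym (∑ˡ-zeros-of j)))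
    into-sum : ∀ j → 𝟙 (Q j) * ∑ˡ (λ T → 𝟙 (key j T)) subsets ≡ ∑ˡ (λ T → 𝟙 (Q j ∧ key j T)) subsets
    into-sum j = trans (sym (∑ˡ-distribˡ-* (𝟙 (Q j)) _ subsets)) (∑ˡ-cong subsets (λ T → sym (𝟙-∧ (Q j) _)))
    fibre : ∀ T → sum (λ j → 𝟙 (Q j ∧ key j T)) ≤ suc λ' * 𝟙 (sizeℓ T)
    fibre T with sizeℓ T in ∣T∣≡ℓ
    ... | false = ≤-reflexive (trans (sum-cong-≗ (λ j → cong 𝟙 (∧-zeroʳ (Q j))))
                                     (trans (sum-const n 0) (trans (*-zeroʳ n) (sym (*-zeroʳ (suc λ'))))))
    ... | true  = subst₂ _≤_ (countF≡sum (λ j → Q j ∧ sameSet T (zeros-of j))) (sym (*-identityʳ (suc λ')))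
      (few-columns S T (λ j → Q j ∧ sameSet T (zeros-of j)) (≤-reflexive (sym (≡ᵇ-true⇒ ∣S∣≡t)))
        (≤-reflexive (sym (≡ᵇ-true⇒ ∣T∣≡ℓ)))
        (λ j q → ones j (proj₁ (∧-true⇒ q)))
        (λ j q r Tr → not-true⇒ (prefix-⊆ (λ r → not (A r j)) ℓ r
                        (trans (sym (sameSet-true⇒ T (zeros-of j) (proj₂ (∧-true⇒ q)) r)) Tr))))

  K E′ : ℕ
  K  = suc t + λ'
  E′ = suc t * (suc λ' * binomial m ℓ)

  near : Subset m → ℕ
  near S = 𝟙 (sizeT S ∧ subsetᵇ S low)

  inY : Subset m → Bool
  inY S = ((∣ S ∣ ≡ᵇ t) ∧ (d t A S ≡ᵇ λ')) ∧ (μ t A S ≡ᵇ 1)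

  weight-¬sizeT : ∀ S → sizeT S ≡ false → weight S ≡ 0
  weight-¬sizeT S ∣S∣≢t = begin
    t * #coversT S + #covers S  ≡⟨ cong₂ (λ a b → t * a + b) (countF-none T-false) (countF-none uncovered) ⟩
    t * 0 + 0                   ≡⟨ trans (+-identityʳ (t * 0)) (*-zeroʳ t) ⟩
    0                           ∎
    where
    open ≡-Reasoning
    uncovered : ∀ j → covers S j ≡ false
    uncovered j = cong (_∧ subsetᵇ S (top j)) ∣S∣≢t
    T-false : ∀ j → (colT j ∧ covers S j) ≡ false
    T-false j = trans (cong (colT j ∧_) (uncovered j)) (∧-zeroʳ (colT j))
    countF-none : ∀ {q : Fin n → Bool} → (∀ j → q j ≡ false) → countF q ≡ 0
    countF-none h = trans (countF-cong h) (countF-false n)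

  weight≤E′ : ∀ S → sizeT S ≡ true → weight S ≤ E′
  weight≤E′ S ∣S∣≡t = begin
    t * #coversT S + #covers S  ≤⟨ +-monoˡ-≤ (#covers S) (*-monoʳ-≤ t (countF-mono (λ j → proj₂ ∘ ∧-true⇒ {colT j}))) ⟩
    t * #covers S + #covers S   ≡⟨ +-comm (t * #covers S) (#covers S) ⟩
    suc t * #covers S           ≤⟨ *-monoʳ-≤ (suc t) (#columns-⊇ S ∣S∣≡t (covers S) (covers⇒ones S)) ⟩
    E′                          ∎
    where open ≤-Reasoning

  near-¬far : ∀ S → sizeT S ≡ true → far S ≡ false → near S ≡ 1
  near-¬far S ∣S∣≡t ¬far = cong 𝟙 (⇒∧-true ∣S∣≡t (¬far⇒⊆low S ¬far))

  weight-bound : ∀ S → weight S ≤ 𝟙 (sizeT S) * K + near S * E′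
  weight-bound S with true-or-false (sizeT S) | true-or-false (far S)
  ... | inj₂ ∣S∣≢t | _ = ≤-trans (≤-reflexive (weight-¬sizeT S ∣S∣≢t)) z≤n
  ... | inj₁ ∣S∣≡t | inj₂ ¬far = begin
    weight S                     ≤⟨ weight≤E′ S ∣S∣≡t ⟩
    E′                           ≡⟨ *-identityˡ E′ ⟨
    1 * E′                       ≡⟨ cong (_* E′) (near-¬far S ∣S∣≡t ¬far) ⟨
    near S * E′                  ≤⟨ m≤n+m _ _ ⟩
    1 * K + near S * E′          ≡⟨ cong (λ b → 𝟙 b * K + near S * E′) ∣S∣≡t ⟨
    𝟙 (sizeT S) * K + near S * E′ ∎
    where open ≤-Reasoning
  ... | inj₁ ∣S∣≡t | inj₁ far-S = begin
    t * #coversT S + #covers S   ≤⟨ +-mono-≤ (*-monoʳ-≤ t (#coversT≤1 S)) (#covers-far S ∣S∣≡t far-S) ⟩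
    t * 1 + suc λ'               ≡⟨ cong (_+ suc λ') (*-identityʳ t) ⟩
    t + suc λ'                   ≡⟨ +-suc t λ' ⟩
    K                            ≡⟨ *-identityˡ K ⟨
    1 * K                        ≤⟨ m≤m+n (1 * K) _ ⟩
    1 * K + near S * E′          ≡⟨ cong (λ b → 𝟙 b * K + near S * E′) ∣S∣≡t ⟨
    𝟙 (sizeT S) * K + near S * E′ ∎
    where open ≤-Reasoning

  weight-bound-strict : ∀ S → 𝟙 (sizeT S) + weight S ≤ 𝟙 (inY S) + 𝟙 (sizeT S) * K + #coversLarge S + near S * suc E′
  weight-bound-strict S with true-or-false (sizeT S) | true-or-false (far S)
  ... | inj₂ ∣S∣≢t | _ =
    ≤-trans (≤-reflexive (cong₂ _+_ (cong 𝟙 ∣S∣≢t) (weight-¬sizeT S ∣S∣≢t))) z≤n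
  ... | inj₁ ∣S∣≡t | inj₂ ¬far = begin
    𝟙 (sizeT S) + weight S        ≡⟨ cong (λ b → 𝟙 b + weight S) ∣S∣≡t ⟩
    1 + weight S                  ≤⟨ s≤s (weight≤E′ S ∣S∣≡t) ⟩
    suc E′                        ≡⟨ *-identityˡ (suc E′) ⟨
    1 * suc E′                    ≡⟨ cong (_* suc E′) (near-¬far S ∣S∣≡t ¬far) ⟨
    near S * suc E′               ≤⟨ m≤n+m _ _ ⟩
    𝟙 (inY S) + 𝟙 (sizeT S) * K + #coversLarge S + near S * suc E′ ∎
    where open ≤-Reasoning
  ... | inj₁ ∣S∣≡t | inj₁ far-S = begin
    𝟙 (sizeT S) + weight S                ≡⟨ cong (λ b → 𝟙 b + weight S) ∣S∣≡t ⟩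
    1 + weight S                          ≤⟨ far-weight-arithmetic t λ' (#coversT S) (#covers S) (#coversT₊₁ S) (#coversLarge S)
                                               (𝟙 (inY S)) 1≤t (#covers-far S ∣S∣≡t far-S) (#coversT≤1 S) (#covers-split S) inY-if ⟩
    𝟙 (inY S) + K + #coversLarge S        ≡⟨ cong (λ k → 𝟙 (inY S) + k + #coversLarge S) (*-identityˡ K) ⟨
    𝟙 (inY S) + 1 * K + #coversLarge S    ≡⟨ cong (λ b → 𝟙 (inY S) + 𝟙 b * K + #coversLarge S) ∣S∣≡t ⟨
    𝟙 (inY S) + 𝟙 (sizeT S) * K + #coversLarge S                    ≤⟨ m≤m+n _ _ ⟩
    𝟙 (inY S) + 𝟙 (sizeT S) * K + #coversLarge S + near S * suc E′ ∎
    where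
    open ≤-Reasoning
    inY-if : #coversT S ≡ 1 → #coversT₊₁ S ≡ λ' → 𝟙 (inY S) ≡ 1
    inY-if one d≡λ' = cong 𝟙 (⇒∧-true (⇒∧-true ∣S∣≡t (⇒≡ᵇ-true (trans (sym (#coversT₊₁≡d S ∣S∣≡t)) d≡λ')))
                                      (⇒≡ᵇ-true (1≤#coversT⇒μ≡1 S ∣S∣≡t (≤-reflexive (sym one)))))

  δ : ℕ
  δ = proj₁ (binomial[2+n,n]-excess t 1≤t)

  1≤δ : 1 ≤ δ
  1≤δ = proj₁ (proj₂ (binomial[2+n,n]-excess t 1≤t))

  binomial[2+t,t]≡ : binomial (2 + t) t ≡ suc t + δ
  binomial[2+t,t]≡ = proj₂ (proj₂ (binomial[2+n,n]-excess t 1≤t))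

  #large : ℕ
  #large = countF colLarge

  binomial-∣top∣ : ∀ j s → colSum A j ≡ s → s ≤ 2 + t → binomial ∣ top j ∣ t ≡ binomial s t
  binomial-∣top∣ j s sum≡s s≤2+t =
    cong (λ x → binomial x t) (trans (∣top∣ j) (trans (cong (_⊓ (2 + t)) sum≡s) (m≤n⇒m⊓n≡m s≤2+t)))

  binomial-∣top∣-large : ∀ j → 2 + t ≤ colSum A j → binomial ∣ top j ∣ t ≡ binomial (2 + t) t
  binomial-∣top∣-large j large = cong (λ x → binomial x t) (trans (∣top∣ j) (m≥n⇒m⊓n≡n large))

  ∑ˡ-column-weight : ∀ j → ∑ˡ (λ S → contribution S j) subsets ≡ suc t + 𝟙 (colLarge j) * δ
  ∑ˡ-column-weight j = begin
    ∑ˡ (λ S → contribution S j) subsets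
      ≡⟨ ∑ˡ-distrib-+ (λ S → t * 𝟙 (colT j ∧ covers S j)) (λ S → 𝟙 (covers S j)) subsets ⟩
    ∑ˡ (λ S → t * 𝟙 (colT j ∧ covers S j)) subsets + ∑ˡ (λ S → 𝟙 (covers S j)) subsets
      ≡⟨ cong₂ _+_ (∑ˡ-distribˡ-* t (λ S → 𝟙 (colT j ∧ covers S j)) subsets) (∑ˡ-subsets-⊆ m (top j) t) ⟩
    t * ∑ˡ (λ S → 𝟙 (colT j ∧ covers S j)) subsets + binomial ∣ top j ∣ t
      ≡⟨ by-kind (kind j) ⟩
    suc t + 𝟙 (colLarge j) * δ ∎
    where
    open ≡-Reasoning
    by-kind : Kind j →
      t * ∑ˡ (λ S → 𝟙 (colT j ∧ covers S j)) subsets + binomial ∣ top j ∣ t ≡ suc t + 𝟙 (colLarge j) * δ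
    by-kind (sum-t e a _ c)
      rewrite a | c | ∑ˡ-subsets-⊆ m (top j) t | binomial-∣top∣ j t e (m≤n+m t 2) | binomial-diag t =
      trans (cong (_+ 1) (*-identityʳ t)) (trans (+-comm t 1) (sym (+-identityʳ (suc t))))
    by-kind (sum-t+1 e a _ c)
      rewrite a | c | binomial-∣top∣ j (suc t) e (n≤1+n _) | binomial-suc-diag t =
      trans (cong (_+ suc t) (trans (cong (t *_) (∑ˡ-zero subsets (λ _ → refl))) (*-zeroʳ t))) (sym (+-identityʳ (suc t)))
    by-kind (sum-≥t+2 large a _ c) rewrite a | c | binomial-∣top∣-large j large =
      trans (cong (_+ binomial (2 + t) t) (trans (cong (t *_) (∑ˡ-zero subsets (λ _ → refl))) (*-zeroʳ t)))
            (trans binomial[2+t,t]≡ (cong (suc t +_) (sym (+-identityʳ δ))))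

  ∑ˡ-column-large : ∀ j → ∑ˡ (λ S → 𝟙 (colLarge j ∧ covers S j)) subsets ≡ 𝟙 (colLarge j) * (suc t + δ)
  ∑ˡ-column-large j with kind j
  ... | sum-t    _ _ _ c rewrite c = ∑ˡ-zero subsets (λ _ → refl)
  ... | sum-t+1  _ _ _ c rewrite c = ∑ˡ-zero subsets (λ _ → refl)
  ... | sum-≥t+2 large _ _ c rewrite c =
    trans (∑ˡ-subsets-⊆ m (top j) t) (trans (binomial-∣top∣-large j large) (trans binomial[2+t,t]≡ (sym (+-identityʳ _))))

  weight≡sum : ∀ S → weight S ≡ sum (contribution S)
  weight≡sum S = begin
    t * countF (λ j → colT j ∧ covers S j) + countF (covers S)
      ≡⟨ cong₂ (λ a b → t * a + b) (countF≡sum (λ j → colT j ∧ covers S j)) (countF≡sum (covers S)) ⟩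
    t * sum (λ j → 𝟙 (colT j ∧ covers S j)) + sum (λ j → 𝟙 (covers S j))
      ≡⟨ cong (_+ sum (λ j → 𝟙 (covers S j))) (*-distribˡ-sum t (λ j → 𝟙 (colT j ∧ covers S j))) ⟩
    sum (λ j → t * 𝟙 (colT j ∧ covers S j)) + sum (λ j → 𝟙 (covers S j))
      ≡⟨ ∑-distrib-+ (λ j → t * 𝟙 (colT j ∧ covers S j)) (λ j → 𝟙 (covers S j)) ⟨
    sum (contribution S)
      ∎
    where open ≡-Reasoning

  sum-large : ∀ k → sum (λ j → 𝟙 (colLarge j) * k) ≡ k * #large
  sum-large k = begin
    sum (λ j → 𝟙 (colLarge j) * k)  ≡⟨ sum-cong-≗ (λ j → *-comm (𝟙 (colLarge j)) k) ⟩
    sum (λ j → k * 𝟙 (colLarge j))  ≡⟨ *-distribˡ-sum k (𝟙 ∘ colLarge) ⟨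
    k * sum (𝟙 ∘ colLarge)          ≡⟨ cong (k *_) (countF≡sum colLarge) ⟨
    k * #large                      ∎
    where open ≡-Reasoning

  ∑ˡ-weight : ∑ˡ weight subsets ≡ n * suc t + δ * #large
  ∑ˡ-weight = begin
    ∑ˡ weight subsets
      ≡⟨ ∑ˡ-cong subsets weight≡sum ⟩
    ∑ˡ (λ S → sum (contribution S)) subsets
      ≡⟨ ∑ˡ-sum-comm contribution subsets ⟩
    sum (λ j → ∑ˡ (λ S → contribution S j) subsets)
      ≡⟨ sum-cong-≗ ∑ˡ-column-weight ⟩
    sum (λ j → suc t + 𝟙 (colLarge j) * δ)
      ≡⟨ ∑-distrib-+ (λ _ → suc t) (λ j → 𝟙 (colLarge j) * δ) ⟩
    sum {n} (λ _ → suc t) + sum (λ j → 𝟙 (colLarge j) * δ)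
      ≡⟨ cong₂ _+_ (sum-const n (suc t)) (sum-large δ) ⟩
    n * suc t + δ * #large
      ∎
    where open ≡-Reasoning

  ∑ˡ-#coversLarge : ∑ˡ #coversLarge subsets ≡ (suc t + δ) * #large
  ∑ˡ-#coversLarge = begin
    ∑ˡ #coversLarge subsets
      ≡⟨ ∑ˡ-cong subsets (λ S → countF≡sum (λ j → colLarge j ∧ covers S j)) ⟩
    ∑ˡ (λ S → sum (λ j → 𝟙 (colLarge j ∧ covers S j))) subsets
      ≡⟨ ∑ˡ-sum-comm (λ S j → 𝟙 (colLarge j ∧ covers S j)) subsets ⟩
    sum (λ j → ∑ˡ (λ S → 𝟙 (colLarge j ∧ covers S j)) subsets)
      ≡⟨ sum-cong-≗ ∑ˡ-column-large ⟩
    sum (λ j → 𝟙 (colLarge j) * (suc t + δ))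
      ≡⟨ sum-large (suc t + δ) ⟩
    (suc t + δ) * #large
      ∎
    where open ≡-Reasoning

  #near : ℕ
  #near = ∑ˡ near subsets

  #near≤ : #near ≤ binomial M₀ t
  #near≤ = ≤-trans (≤-reflexive (∑ˡ-subsets-⊆ m low t))
                   (binomial-monoˡ t (≤-trans (≤-reflexive (countF-<ᵇ m M₀)) (m⊓n≤n m M₀)))

  #Y : ℕ
  #Y = length (Yset t λ' A)

  ∑ˡ-sizeT*K : ∑ˡ (λ S → 𝟙 (sizeT S) * K) subsets ≡ binomial m t * K
  ∑ˡ-sizeT*K = trans (∑ˡ-distribʳ-* K (𝟙 ∘ sizeT) subsets) (cong (_* K) (∑ˡ-subsets-size m t))

  ∑ˡ-weight≤ : ∑ˡ weight subsets ≤ binomial m t * K + #near * E′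
  ∑ˡ-weight≤ = begin
    ∑ˡ weight subsets                                             ≤⟨ ∑ˡ-mono-≤ subsets weight-bound ⟩
    ∑ˡ (λ S → 𝟙 (sizeT S) * K + near S * E′) subsets               ≡⟨ ∑ˡ-distrib-+ (λ S → 𝟙 (sizeT S) * K) (λ S → near S * E′) subsets ⟩
    ∑ˡ (λ S → 𝟙 (sizeT S) * K) subsets + ∑ˡ (λ S → near S * E′) subsets
                                                                  ≡⟨ cong₂ _+_ ∑ˡ-sizeT*K (∑ˡ-distribʳ-* E′ near subsets) ⟩
    binomial m t * K + #near * E′                                 ∎
    where open ≤-Reasoning

  ∑ˡ-weight≤-strict : binomial m t + ∑ˡ weight subsets ≤ #Y + binomial m t * K + ∑ˡ #coversLarge subsets + #near * suc E′
  ∑ˡ-weight≤-strict = begin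
    binomial m t + ∑ˡ weight subsets
      ≡⟨ cong (_+ ∑ˡ weight subsets) (∑ˡ-subsets-size m t) ⟨
    ∑ˡ (𝟙 ∘ sizeT) subsets + ∑ˡ weight subsets
      ≡⟨ ∑ˡ-distrib-+ (𝟙 ∘ sizeT) weight subsets ⟨
    ∑ˡ (λ S → 𝟙 (sizeT S) + weight S) subsets
      ≤⟨ ∑ˡ-mono-≤ subsets weight-bound-strict ⟩
    ∑ˡ (λ S → 𝟙 (inY S) + 𝟙 (sizeT S) * K + #coversLarge S + near S * suc E′) subsets
      ≡⟨ ∑ˡ-distrib-+ (λ S → 𝟙 (inY S) + 𝟙 (sizeT S) * K + #coversLarge S) (λ S → near S * suc E′) subsets ⟩
    ∑ˡ (λ S → 𝟙 (inY S) + 𝟙 (sizeT S) * K + #coversLarge S) subsets + ∑ˡ (λ S → near S * suc E′) subsets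
      ≡⟨ cong₂ _+_ (∑ˡ-distrib-+ (λ S → 𝟙 (inY S) + 𝟙 (sizeT S) * K) #coversLarge subsets) (∑ˡ-distribʳ-* (suc E′) near subsets) ⟩
    ∑ˡ (λ S → 𝟙 (inY S) + 𝟙 (sizeT S) * K) subsets + ∑ˡ #coversLarge subsets + #near * suc E′
      ≡⟨ cong (λ z → z + ∑ˡ #coversLarge subsets + #near * suc E′) (∑ˡ-distrib-+ (𝟙 ∘ inY) (λ S → 𝟙 (sizeT S) * K) subsets) ⟩
    ∑ˡ (𝟙 ∘ inY) subsets + ∑ˡ (λ S → 𝟙 (sizeT S) * K) subsets + ∑ˡ #coversLarge subsets + #near * suc E′
      ≡⟨ cong₂ (λ a b → a + b + ∑ˡ #coversLarge subsets + #near * suc E′) (sym (length-filter inY subsets)) ∑ˡ-sizeT*K ⟩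
    #Y + binomial m t * K + ∑ˡ #coversLarge subsets + #near * suc E′
      ∎
    where open ≤-Reasoning

  1≤E′ : 1 ≤ E′
  1≤E′ = *-mono-≤ {1} {suc t} (s≤s z≤n) (*-mono-≤ {1} {suc λ'} (s≤s z≤n) (binomial-pos m ℓ ℓ≤m))

  counting-bound : (t + 1 + λ') * (m C t) < (t + 1) * n →
    m C t ≤ #Y + (3 + t) * binomial M₀ t * (suc t * suc λ') * binomial m ℓ
  counting-bound many = begin
    m C t                                        ≡⟨ binomial≡C m t ⟨
    binomial m t                                 <⟨ cancel-bound (binomial m t) (n * suc t) (binomial m t * K) #large δ (suc t)
                                                                 #Y (#near * suc E′) few-t-sets summed ⟩
    #Y + suc t * #large + #near * suc E′         ≤⟨ +-monoˡ-≤ (#near * suc E′) (+-monoʳ-≤ #Y (*-monoʳ-≤ (suc t) few-large)) ⟩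
    #Y + suc t * (#near * E′) + #near * suc E′   ≤⟨ error-term-bound #Y (suc t) #near E′ 1≤E′ ⟩
    #Y + (3 + t) * (#near * E′)                  ≤⟨ +-monoʳ-≤ #Y (*-monoʳ-≤ (3 + t) (*-monoˡ-≤ E′ #near≤)) ⟩
    #Y + (3 + t) * (binomial M₀ t * E′)          ≡⟨ cong (#Y +_) (regroup (3 + t) (binomial M₀ t) (suc t) (suc λ') (binomial m ℓ)) ⟩
    #Y + (3 + t) * binomial M₀ t * (suc t * suc λ') * binomial m ℓ ∎
    where
    open ≤-Reasoning
    regroup : ∀ a b c d e → a * (b * (c * (d * e))) ≡ a * b * (c * d) * e
    regroup = solve-∀
    few-t-sets : binomial m t * K < n * suc t
    few-t-sets = subst₂ _<_ (trans (cong₂ _*_ (cong (_+ λ') (+-comm t 1)) (sym (binomial≡C m t))) (*-comm _ (binomial m t)))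
                            (trans (cong (_* n) (+-comm t 1)) (*-comm (suc t) n)) many
    summed : binomial m t + (n * suc t + δ * #large) ≤ #Y + binomial m t * K + (suc t + δ) * #large + #near * suc E′
    summed = subst₂ (λ w l → binomial m t + w ≤ #Y + binomial m t * K + l + #near * suc E′)
                    ∑ˡ-weight ∑ˡ-#coversLarge ∑ˡ-weight≤-strict
    few-large : #large ≤ #near * E′
    few-large = excess-bound (n * suc t) (binomial m t * K) #large δ (#near * E′) 1≤δ few-t-sets
                             (subst (_≤ binomial m t * K + #near * E′) ∑ˡ-weight ∑ˡ-weight≤)

lemma3 : (t ℓ λ' : ℕ) → ℓ < t → 1 ≤ λ' →
    Σ ℕ λ c₃ →
    (m n : ℕ) → t + ℓ + λ' + 2 ≤ m → (A : Matrix m n) →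
    ¬ (copies (λ' + 2) (onesZeros t ℓ) ≺ A) →
    (∀ j → t ≤ colSum A j × colSum A j ≤ m ∸ ℓ) →
    (∀ j j' → colSum A j ≡ t → colSum A j' ≡ t → (∀ i → A i j ≡ A i j') → j ≡ j') →
    (t + 1 + λ') * (m C t) < (t + 1) * n →
    m C t ≤ length (Yset t λ' A) + c₃ * m ^ (t ∸ 1)
lemma3 t ℓ λ' ℓ<t _ = c₃ , λ m n m-large A ≺-free sums-in-range simple many →
  let t+ℓ≤m = ≤-trans (m≤m+n (t + ℓ) (λ' + 2)) (≤-trans (≤-reflexive (sym (+-assoc (t + ℓ) λ' 2))) m-large)
      open Counting t ℓ λ' ℓ<t (≤-trans (m≤n+m ℓ t) t+ℓ≤m) A ≺-free sums-in-range simple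
      instance _ = >-nonZero (≤-trans 1≤t (≤-trans (m≤m+n t ℓ) t+ℓ≤m))
  in begin
    m C t                                             ≤⟨ counting-bound many ⟩
    length (Yset t λ' A) + c₃ * binomial m ℓ          ≤⟨ +-monoʳ-≤ _ (*-monoʳ-≤ c₃ (binomial≤^ m ℓ)) ⟩
    length (Yset t λ' A) + c₃ * m ^ ℓ                 ≤⟨ +-monoʳ-≤ _ (*-monoʳ-≤ c₃ (^-monoʳ-≤ m (∸-monoˡ-≤ 1 ℓ<t))) ⟩
    length (Yset t λ' A) + c₃ * m ^ (t ∸ 1)           ∎
  where
  open ≤-Reasoning
  c₃ : ℕ
  c₃ = (3 + t) * binomial (ℓ + (λ' + 2) * (2 + t)) t * (suc t * suc λ')
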